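{- Let $\mathsf L$ be any of the logics $\mathsf{N}_\preccurlyeq$, $\mathsf{NN}_\preccurlyeq$, $\mathsf{NT}_\preccurlyeq$, $\mathsf{NW}_\preccurlyeq$, $\mathsf{NC}_\preccurlyeq$ or any of their U- or A-extensions. Let $\Phi$ be an $\mathsf L$-maximal consistent set of formulas and let $\Sigma$ be a cut around $\Phi$. Then for every formula $A$: $A\in\Sigma$ if and only if for all $\Psi\in\Sigma^{c}$, $A\notin\Psi$.
   Context: Language: formulas $A ::= p \mid \bot \mid A\to A \mid A \preccurlyeq A$ over countably many atoms; $\top,\neg,\wedge,\vee$ defined as usual. Axioms and rules: (cpr) from $A\to B$ infer $B\preccurlyeq A$; (tr) $(A\preccurlyeq B)\wedge(B\preccurlyeq C)\to(A\preccurlyeq C)$; (or) $(A\preccurlyeq B)\wedge(A\preccurlyeq C)\to(A\preccurlyeq B\vee C)$; (n) $\neg(\bot\preccurlyeq\top)$; (t) $(\bot\preccurlyeq A)\to\neg A$; (w) $A\to(A\preccurlyeq\top)$; (c) $(A\preccurlyeq\top)\to A$; (u$-$) $\neg(\bot\preccurlyeq A)\to(\bot\preccurlyeq(\bot\preccurlyeq A))$; (u) $(\bot\preccurlyeq A)\to(\bot\preccurlyeq\neg(\bot\preccurlyeq A))$; (a$-$) $(A\preccurlyeq B)\to(\bot\preccurlyeq\neg(A\preccurlyeq B))$; (a) $\neg(A\preccurlyeq B)\to(\bot\preccurlyeq(A\preccurlyeq B))$. $\mathsf{N}_\preccurlyeq$ = classical propositional logic plus tr, or, cpr; $\mathsf{NN}_\preccurlyeq=\mathsf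 N_\preccurlyeq+$n; $\mathsf{NT}_\preccurlyeq=\mathsf N_\preccurlyeq+$t; $\mathsf{NW}_\preccurlyeq=\mathsf{NT}_\preccurlyeq+$w; $\mathsf{NC}_\preccurlyeq=\mathsf{NW}_\preccurlyeq+$c; the U-extension of such $\mathsf L$ adds u$-$,u and the A-extension adds a$-$,a. Derivability $\vdash_{\mathsf L}$: finite sequence of axioms, modus ponens and cpr applications. $A$ is deducible from a set $\Phi$ if $\vdash_{\mathsf L} B_1\wedge\dots\wedge B_n\to A$ for some finite $\{B_1,\dots,B_n\}\subseteq\Phi$. $\Phi$ is $\mathsf L$-consistent if $\bot$ is not deducible from it, and $\mathsf L$-maximal consistent (maxcons) if consistent and for every $B\notin\Phi$, $\Phi\cup\{B\}$ is inconsistent. A set of formulas $\Sigma$ is a cut around a maxcons set $\Phi$ if for all finite sets $\{B_1,\dots,B_n\}\subseteq\Sigma$ and all formulas $A\notin\Sigma$, $(B_1\vee\dots\vee B_n)\preccurlyeq A\notin\Phi$. $\Sigma^{c}$ denotes the set of all $\mathsf L$-maxcons sets $\Psi$ with $\Psi\cap\Sigma=\emptyset$. -}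

module Defs where

open import Data.Nat using (ℕ)
open import Data.List using (List; []; _∷_)
open import Data.List.Relation.Unary.All using (All)
open import Data.Product using (Σ; _×_; ∃)
open import Data.Empty using (⊥)
open import Data.Sum using (_⊎_)
open import Relation.Nullary using (¬_)
open import Relation.Binary.PropositionalEquality using (_≡_)

infixr 5 _⇒_
infix 6 _≼_

data Formula : Set where
  var  : ℕ → Formula
  falsum : Formula
  _⇒_  : Formula → Formula → Formula
  _≼_  : Formula → Formula → Formula

~_ : Formula → Formula
~ A = A ⇒ falsum

verum : Formula
verum = falsum ⇒ falsum

_∨ᶠ_ : Formula → Formula → Formula
A ∨ᶠ B = (~ A) ⇒ B

_∧ᶠ_ : Formula → Formula → Formula
A ∧ᶠ B = ~ (A ⇒ ~ B)

⋀ : List Formula → Formula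
⋀ [] = verum
⋀ (B ∷ []) = B
⋀ (B ∷ Bs@(_ ∷ _)) = B ∧ᶠ ⋀ Bs

⋁ : List Formula → Formula
⋁ [] = falsum
⋁ (B ∷ []) = B
⋁ (B ∷ Bs@(_ ∷ _)) = B ∨ᶠ ⋁ Bs

data Base : Set where
  N NN NT NW NC : Base

data Ext : Set where
  plain Uext Aext : Ext

record Logic : Set where
  constructor mkLogic
  field
    base : Base
    ext  : Ext
open Logic public

-- which of the axioms n, t, w, c belong to a base logic
-- NN = N + n ; NT = N + t ; NW = NT + w ; NC = NW + c
data HasN : Base → Set where
  nNN : HasN NN

data HasT : Base → Set where
  tNT : HasT NT
  tNW : HasT NW
  tNC : HasT NC

data HasW : Base → Set where
  wNW : HasW NW
  wNC : HasW NC

data HasC : Base → Set where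
  cNC : HasC NC

-- Derivability  ⊢[ L ] A
-- Classical propositional logic is axiomatised by the Łukasiewicz axioms
-- for → and ⊥ together with modus ponens.

infix 3 ⊢[_]_

data ⊢[_]_ (L : Logic) : Formula → Set where
  ax-K  : ∀ {A B} → ⊢[ L ] A ⇒ B ⇒ A
  ax-S  : ∀ {A B C} → ⊢[ L ] (A ⇒ B ⇒ C) ⇒ (A ⇒ B) ⇒ A ⇒ C
  ax-Ct : ∀ {A B} → ⊢[ L ] (~ A ⇒ ~ B) ⇒ B ⇒ A
  mp    : ∀ {A B} → ⊢[ L ] A ⇒ B → ⊢[ L ] A → ⊢[ L ] B
  cpr   : ∀ {A B} → ⊢[ L ] A ⇒ B → ⊢[ L ] B ≼ A
  ax-tr : ∀ {A B C} → ⊢[ L ] ((A ≼ B) ∧ᶠ (B ≼ C)) ⇒ (A ≼ C)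
  ax-or : ∀ {A B C} → ⊢[ L ] ((A ≼ B) ∧ᶠ (A ≼ C)) ⇒ (A ≼ (B ∨ᶠ C))
  ax-n  : HasN (base L) → ⊢[ L ] ~ (falsum ≼ verum)
  ax-t  : ∀ {A} → HasT (base L) → ⊢[ L ] (falsum ≼ A) ⇒ ~ A
  ax-w  : ∀ {A} → HasW (base L) → ⊢[ L ] A ⇒ (A ≼ verum)
  ax-c  : ∀ {A} → HasC (base L) → ⊢[ L ] (A ≼ verum) ⇒ A
  ax-u⁻ : ∀ {A} → ext L ≡ Uext →
          ⊢[ L ] ~ (falsum ≼ A) ⇒ (falsum ≼ (falsum ≼ A))
  ax-u  : ∀ {A} → ext L ≡ Uext →
          ⊢[ L ] (falsum ≼ A) ⇒ (falsum ≼ ~ (falsum ≼ A))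
  ax-a⁻ : ∀ {A B} → ext L ≡ Aext →
          ⊢[ L ] (A ≼ B) ⇒ (falsum ≼ ~ (A ≼ B))
  ax-a  : ∀ {A B} → ext L ≡ Aext →
          ⊢[ L ] ~ (A ≼ B) ⇒ (falsum ≼ (A ≼ B))

FSet : Set₁
FSet = Formula → Set

Deducible : Logic → FSet → Formula → Set
Deducible L Φ A = Σ (List Formula) λ Bs → All Φ Bs × (⊢[ L ] ⋀ Bs ⇒ A)

Consistent : Logic → FSet → Set
Consistent L Φ = ¬ Deducible L Φ falsum

_∪｛_｝ : FSet → Formula → FSet
(Φ ∪｛ B ｝) C = Φ C ⊎ C ≡ B

MaxCons : Logic → FSet → Set
MaxCons L Φ = Consistent L Φ × (∀ B → ¬ Φ B → ¬ Consistent L (Φ ∪｛ B ｝))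

IsCut : FSet → FSet → Set
IsCut Φ S = ∀ (Bs : List Formula) → All S Bs →
            ∀ A → ¬ S A → ¬ Φ (⋁ Bs ≼ A)

InComplement : Logic → FSet → FSet → Set
InComplement L S Ψ = MaxCons L Ψ × (∀ B → Ψ B → S B → ⊥)

-- If A ∉ Σ, then {A} proves no disjunction of members of Σ: from ⊢ A → B₁ ∨ … ∨ Bₙ, rule cpr
-- puts (B₁ ∨ … ∨ Bₙ) ≼ A into the maxcons set Φ, which the cut Σ forbids. A Lindenbaum
-- construction over an enumeration of all formulas extends {A} to a set Ψ that is maximal
-- among the sets proving no such disjunction; Ψ is then maximal consistent and disjoint
-- from Σ, so Ψ ∈ Σᶜ contains A.
module Submission where

open import Defs
open import Level using (0ℓ)
open import Axiom.ExcludedMiddle using (ExcludedMiddle)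
open import Function.Bundles using (_⇔_; mk⇔)
open import Relation.Nullary using (¬_; yes; no)
open import Relation.Nullary.Decidable using (decidable-stable)
open import Relation.Unary using (_⊆_; ⋃; ｛_｝)
open import Data.Nat using (ℕ; zero; suc; _+_)
open import Data.Nat.Properties using (+-comm)
open import Data.List using (List; []; _∷_; _++_; cartesianProductWith)
open import Data.List.Relation.Unary.All as All using (All; []; _∷_)
open import Data.List.Relation.Unary.All.Properties using (++⁺)
open import Data.List.Relation.Unary.Any using (here; there)
open import Data.List.Membership.Propositional using (_∈_)
open import Data.List.Membership.Propositional.Properties
  using (∈-++⁺ˡ; ∈-++⁺ʳ; ∈-cartesianProductWith⁺)
open import Data.List.Relation.Binary.Subset.Propositional using () renaming (_⊆_ to _⊆ˡ_)
open import Data.List.Relation.Binary.Subset.Propositional.Properties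
  using (xs⊆x∷xs; xs⊆xs++ys; xs⊆ys++xs; ∷⁺ʳ)
open import Data.Product using (Σ; ∃; _×_; _,_; proj₁)
open import Data.Sum using (_⊎_; inj₁; inj₂; [_,_]; map₁; map₂)
open import Data.Empty using (⊥; ⊥-elim)
open import Function.Base using (id)
open import Relation.Binary.PropositionalEquality using (_≡_; refl; sym; subst)

variable
  A B D X Y Z : Formula
  Γ Γ' Bs Cs : List Formula
  Δ Δ' : FSet

module _ (Δs : ℕ → FSet) (Δs-mono : ∀ n → Δs n ⊆ Δs (suc n)) where

  chain-⊆ : ∀ k {n} → Δs n ⊆ Δs (k + n)
  chain-⊆ zero p = p
  chain-⊆ (suc k) p = Δs-mono _ (chain-⊆ k p)

  chain-⊆′ : ∀ k {n} → Δs n ⊆ Δs (n + k)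
  chain-⊆′ k {n} {D} p = subst (λ m → Δs m D) (+-comm k n) (chain-⊆ k p)

  chain-All : All (⋃ ℕ Δs) Cs → ∃ λ n → All (Δs n) Cs
  chain-All [] = 0 , []
  chain-All ((m , p) ∷ ps) with chain-All ps
  ... | n , qs = n + m , chain-⊆ n p ∷ All.map (chain-⊆′ m) qs

formulas : ℕ → List Formula
formulas zero = []
formulas (suc n) =
  falsum ∷ var n ∷ (fs ++ cartesianProductWith _⇒_ fs fs ++ cartesianProductWith _≼_ fs fs)
  where fs = formulas n

formulas-mono : ∀ n → (_∈ formulas n) ⊆ (_∈ formulas (suc n))
formulas-mono n p = there (there (∈-++⁺ˡ p))

formulas-complete : ∀ C → ∃ λ n → C ∈ formulas n
formulas-complete₂ : ∀ C C′ → ∃ λ n → C ∈ formulas n × C′ ∈ formulas n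

formulas-complete (var k) = suc k , there (here refl)
formulas-complete falsum = 1 , here refl
formulas-complete (C ⇒ C′) with formulas-complete₂ C C′
... | n , p , q = suc n , there (there (∈-++⁺ʳ (formulas n)
                                        (∈-++⁺ˡ (∈-cartesianProductWith⁺ _⇒_ p q))))
formulas-complete (C ≼ C′) with formulas-complete₂ C C′
... | n , p , q = suc n , there (there (∈-++⁺ʳ (formulas n)
                                        (∈-++⁺ʳ _ (∈-cartesianProductWith⁺ _≼_ p q))))

formulas-complete₂ C C′
  with chain-All (λ n → _∈ formulas n) formulas-mono (formulas-complete C ∷ formulas-complete C′ ∷ [])
... | n , p ∷ q ∷ [] = n , p , q

module Deduction (L : Logic) where

  infix 3 _⊢_ _⊩_

  data _⊢_ (Γ : List Formula) : Formula → Set where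
    hyp : A ∈ Γ → Γ ⊢ A
    thm : ⊢[ L ] A → Γ ⊢ A
    app : Γ ⊢ A ⇒ B → Γ ⊢ A → Γ ⊢ B

  #0 : A ∷ Γ ⊢ A
  #0 = hyp (here refl)

  #1 : B ∷ A ∷ Γ ⊢ A
  #1 = hyp (there (here refl))

  weaken : Γ ⊆ˡ Γ' → Γ ⊢ A → Γ' ⊢ A
  weaken s (hyp p) = hyp (s p)
  weaken s (thm t) = thm t
  weaken s (app d e) = app (weaken s d) (weaken s e)

  wk : Γ ⊢ A → B ∷ Γ ⊢ A
  wk = weaken (xs⊆x∷xs _ _)

  cut : (∀ {D} → D ∈ Γ' → Γ ⊢ D) → Γ' ⊢ A → Γ ⊢ A
  cut k (hyp p) = k p
  cut k (thm t) = thm t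
  cut k (app d e) = app (cut k d) (cut k e)

  ⇒-refl : ⊢[ L ] A ⇒ A
  ⇒-refl {A} = mp (mp ax-S (ax-K {B = A ⇒ A})) (ax-K {B = A})

  deduction : A ∷ Γ ⊢ B → Γ ⊢ A ⇒ B
  deduction (hyp (here refl)) = thm ⇒-refl
  deduction (hyp (there p)) = app (thm ax-K) (hyp p)
  deduction (thm t) = app (thm ax-K) (thm t)
  deduction (app d e) = app (app (thm ax-S) (deduction d)) (deduction e)

  closed : [] ⊢ A → ⊢[ L ] A
  closed (thm t) = t
  closed (app d e) = mp (closed d) (closed e)

  explode : Γ ⊢ falsum → Γ ⊢ A
  explode = app (app (thm ax-Ct) (thm (mp ax-K ⇒-refl)))

  by-contradiction : ~ A ∷ Γ ⊢ falsum → Γ ⊢ A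
  by-contradiction d = app (app (thm ax-Ct) (deduction (deduction (app #0 #1)))) (deduction d)

  by-cases : D ∷ Γ ⊢ X → ~ D ∷ Γ ⊢ X → Γ ⊢ X
  by-cases {D = D} {Γ = Γ} {X = X} d₁ d₂ =
    by-contradiction (app #0 (app (wk (deduction d₂)) ¬D))
    where
      ¬D : ~ X ∷ Γ ⊢ ~ D
      ¬D = deduction (app #1 (app (wk (wk (deduction d₁))) #0))

  ∧-intro : Γ ⊢ A → Γ ⊢ B → Γ ⊢ A ∧ᶠ B
  ∧-intro a b = deduction (app (app #0 (wk a)) (wk b))

  ∧-elimˡ : Γ ⊢ A ∧ᶠ B → Γ ⊢ A
  ∧-elimˡ d = by-contradiction (app (wk d) (deduction (explode (app #1 #0))))

  ∧-elimʳ : Γ ⊢ A ∧ᶠ B → Γ ⊢ B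
  ∧-elimʳ d = by-contradiction (app (wk d) (deduction #1))

  ∨-introˡ : Γ ⊢ A → Γ ⊢ A ∨ᶠ B
  ∨-introˡ a = deduction (explode (app #0 (wk a)))

  ∨-introʳ : Γ ⊢ B → Γ ⊢ A ∨ᶠ B
  ∨-introʳ b = deduction (wk b)

  ∨-elim : Γ ⊢ A ∨ᶠ B → A ∷ Γ ⊢ X → B ∷ Γ ⊢ X → Γ ⊢ X
  ∨-elim d dA dB = by-cases dA (app (wk (deduction dB)) (app (wk d) #0))

  ⋀-intro : ∀ Bs → (∀ {D} → D ∈ Bs → Γ ⊢ D) → Γ ⊢ ⋀ Bs
  ⋀-intro [] k = thm ⇒-refl
  ⋀-intro (B ∷ []) k = k (here refl)
  ⋀-intro (B ∷ C ∷ Bs) k = ∧-intro (k (here refl)) (⋀-intro (C ∷ Bs) (λ p → k (there p)))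

  ⋀-elim : ∀ Bs → D ∈ Bs → Γ ⊢ ⋀ Bs → Γ ⊢ D
  ⋀-elim (B ∷ []) (here refl) d = d
  ⋀-elim (B ∷ C ∷ Bs) (here refl) d = ∧-elimˡ d
  ⋀-elim (B ∷ C ∷ Bs) (there p) d = ⋀-elim (C ∷ Bs) p (∧-elimʳ d)

  ⋁-intro : D ∈ Bs → Γ ⊢ D → Γ ⊢ ⋁ Bs
  ⋁-intro {Bs = _ ∷ []} (here refl) d = d
  ⋁-intro {Bs = _ ∷ _ ∷ _} (here refl) d = ∨-introˡ d
  ⋁-intro {Bs = _ ∷ _ ∷ _} (there p) d = ∨-introʳ (⋁-intro p d)

  ⋁-elim : ∀ Bs → Γ ⊢ ⋁ Bs → (∀ {D} → D ∈ Bs → D ∷ Γ ⊢ X) → Γ ⊢ X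
  ⋁-elim [] d k = explode d
  ⋁-elim (B ∷ []) d k = app (deduction (k (here refl))) d
  ⋁-elim (B ∷ C ∷ Bs) d k =
    ∨-elim d (k (here refl)) (⋁-elim (C ∷ Bs) #0 (λ p → weaken (∷⁺ʳ _ (xs⊆x∷xs _ _)) (k (there p))))

  ⋁-mono : Bs ⊆ˡ Cs → Γ ⊢ ⋁ Bs → Γ ⊢ ⋁ Cs
  ⋁-mono {Bs} s d = ⋁-elim Bs d (λ p → ⋁-intro (s p) #0)

  _⊩_ : FSet → Formula → Set
  Δ ⊩ X = Σ (List Formula) λ Cs → All Δ Cs × Cs ⊢ X

  Deducible⇒⊩ : Deducible L Δ X → Δ ⊩ X
  Deducible⇒⊩ (Cs , hs , t) = Cs , hs , app (thm t) (⋀-intro Cs hyp)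

  ⊩⇒Deducible : Δ ⊩ X → Deducible L Δ X
  ⊩⇒Deducible (Cs , hs , d) = Cs , hs , closed (deduction (cut (λ p → ⋀-elim Cs p #0) d))

  ⊩-map : (∀ {Γ} → Γ ⊢ X → Γ ⊢ Y) → Δ ⊩ X → Δ ⊩ Y
  ⊩-map f (Cs , hs , d) = Cs , hs , f d

  ⊩-zip : (∀ {Γ} → Γ ⊢ X → Γ ⊢ Y → Γ ⊢ Z) → Δ ⊩ X → Δ ⊩ Y → Δ ⊩ Z
  ⊩-zip f (Cs , hs , d) (Cs' , hs' , d') =
    Cs ++ Cs' , ++⁺ hs hs' , f (weaken (xs⊆xs++ys Cs Cs') d) (weaken (xs⊆ys++xs Cs' Cs) d')

  ⊩-mono : Δ ⊆ Δ' → Δ ⊩ X → Δ' ⊩ X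
  ⊩-mono s (Cs , hs , d) = Cs , All.map s hs , d

  ⊩-chain : (Δs : ℕ → FSet) → (∀ n → Δs n ⊆ Δs (suc n)) → ⋃ ℕ Δs ⊩ X → ∃ λ n → Δs n ⊩ X
  ⊩-chain Δs Δs-mono (Cs , hs , d) with chain-All Δs Δs-mono hs
  ... | n , hs' = n , Cs , hs' , d

  All-∪ : All (Δ ∪｛ D ｝) Cs → Σ (List Formula) λ Es → All Δ Es × Cs ⊆ˡ D ∷ Es
  All-∪ [] = [] , [] , λ ()
  All-∪ {Cs = C ∷ _} (inj₁ h ∷ hs) with All-∪ hs
  ... | Es , hs' , s = C ∷ Es , h ∷ hs' , λ { (here refl) → there (here refl)
                                            ; (there p) → ∷⁺ʳ _ (xs⊆x∷xs Es C) (s p) }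
  All-∪ (inj₂ refl ∷ hs) with All-∪ hs
  ... | Es , hs' , s = Es , hs' , λ { (here refl) → here refl ; (there p) → s p }

  ⊩-deduction : Δ ∪｛ D ｝ ⊩ X → Δ ⊩ D ⇒ X
  ⊩-deduction (Cs , hs , d) with All-∪ hs
  ... | Es , hs' , s = Es , hs' , deduction (weaken s d)

  ⊩-singleton : ｛ A ｝ ⊩ X → ⊢[ L ] A ⇒ X
  ⊩-singleton (Cs , hs , d) = closed (deduction (weaken (λ p → here (sym (All.lookup hs p))) d))

  ProvesSome : FSet → FSet → Set
  ProvesSome S Δ = Σ (List Formula) λ Bs → All S Bs × Δ ⊩ ⋁ Bs

  Avoids : FSet → FSet → Set
  Avoids S Δ = ¬ ProvesSome S Δ

  Avoids-antitone : ∀ {S} → Δ ⊆ Δ' → Avoids S Δ' → Avoids S Δ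
  Avoids-antitone s avoids (Bs , hs , d) = avoids (Bs , hs , ⊩-mono s d)

  Avoids⇒Consistent : ∀ {S} → Avoids S Δ → Consistent L Δ
  Avoids⇒Consistent avoids ded = avoids ([] , [] , Deducible⇒⊩ ded)

  Avoids⇒disjoint : ∀ {S} → Avoids S Δ → ∀ B → Δ B → S B → ⊥
  Avoids⇒disjoint avoids B ΔB SB = avoids (B ∷ [] , SB ∷ [] , B ∷ [] , ΔB ∷ [] , #0)

  ProvesSome-cases : ∀ {S} → ProvesSome S (Δ ∪｛ D ｝) → ProvesSome S (Δ ∪｛ ~ D ｝) →
                     ProvesSome S Δ
  ProvesSome-cases (Bs , hs , d) (Bs' , hs' , d') =
    Bs ++ Bs' , ++⁺ hs hs' ,
    ⊩-zip (λ e e' → by-cases (⋁-mono (xs⊆xs++ys Bs Bs') (app (wk e) #0))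
                             (⋁-mono (xs⊆ys++xs Bs' Bs) (app (wk e') #0)))
          (⊩-deduction d) (⊩-deduction d')

  module Classical (em : ExcludedMiddle 0ℓ) where

    stable : ∀ {P : Set} → ¬ ¬ P → P
    stable = decidable-stable em

    MaxCons-theorem : ∀ {Φ} → MaxCons L Φ → ⊢[ L ] A → Φ A
    MaxCons-theorem {A} {Φ} (Φ-consistent , Φ-maximal) t = stable λ ¬ΦA →
      Φ-maximal A ¬ΦA λ ded →
        Φ-consistent (⊩⇒Deducible (⊩-map (λ d → app d (thm t)) (⊩-deduction (Deducible⇒⊩ ded))))

    cut-avoids : ∀ {Φ S} → MaxCons L Φ → IsCut Φ S → ¬ S A → Avoids S ｛ A ｝
    cut-avoids {A} Φ-maxcons S-cut ¬SA (Bs , hs , d) =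
      S-cut Bs hs A ¬SA (MaxCons-theorem Φ-maxcons (cpr (⊩-singleton d)))

    maximal-avoiding⇒MaxCons : ∀ {S Ψ} → Avoids S Ψ → (∀ D → Avoids S (Ψ ∪｛ D ｝) → Ψ D) →
                               MaxCons L Ψ
    maximal-avoiding⇒MaxCons {Ψ = Ψ} Ψ-avoids Ψ-maximal = Avoids⇒Consistent Ψ-avoids , Ψ-maximal′
      where
        Ψ-maximal′ : ∀ D → ¬ Ψ D → ¬ Consistent L (Ψ ∪｛ D ｝)
        Ψ-maximal′ D ¬ΨD consistent with em {Ψ (~ D)}
        ... | yes Ψ¬D = consistent (⊩⇒Deducible (_ , inj₁ Ψ¬D ∷ inj₂ refl ∷ [] , app #0 #1))
        ... | no ¬Ψ¬D = Ψ-avoids (ProvesSome-cases (stable λ avoids → ¬ΨD (Ψ-maximal D avoids))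
                                                   (stable λ avoids → ¬Ψ¬D (Ψ-maximal (~ D) avoids)))

    module Lindenbaum (S Δ₀ : FSet) where

      extend : Formula → FSet → FSet
      extend C Δ D = Δ D ⊎ (D ≡ C × Avoids S (Δ ∪｛ C ｝))

      extendAll : List Formula → FSet → FSet
      extendAll [] Δ = Δ
      extendAll (C ∷ Cs) Δ = extendAll Cs (extend C Δ)

      stage : ℕ → FSet
      stage zero = Δ₀
      stage (suc n) = extendAll (formulas n) (stage n)

      Ψ : FSet
      Ψ = ⋃ ℕ stage

      extendAll-⊇ : ∀ Cs → Δ ⊆ extendAll Cs Δ
      extendAll-⊇ [] p = p
      extendAll-⊇ (C ∷ Cs) p = extendAll-⊇ Cs (inj₁ p)

      extend-avoids : ∀ C → Avoids S Δ → Avoids S (extend C Δ)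
      extend-avoids {Δ} C avoids with em {Avoids S (Δ ∪｛ C ｝)}
      ... | yes avoids′ = Avoids-antitone (map₂ proj₁) avoids′
      ... | no ¬avoids′ =
        Avoids-antitone [ id , (λ (_ , avoids′) → ⊥-elim (¬avoids′ avoids′)) ] avoids

      extendAll-avoids : ∀ Cs → Avoids S Δ → Avoids S (extendAll Cs Δ)
      extendAll-avoids [] avoids = avoids
      extendAll-avoids (C ∷ Cs) avoids = extendAll-avoids Cs (extend-avoids C avoids)

      extendAll-maximal : ∀ {C} Cs → C ∈ Cs → Avoids S (extendAll Cs Δ ∪｛ C ｝) →
                          extendAll Cs Δ C
      extendAll-maximal (C ∷ Cs) (here refl) avoids =
        extendAll-⊇ Cs (inj₂ (refl , Avoids-antitone (map₁ (λ p → extendAll-⊇ Cs (inj₁ p))) avoids))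
      extendAll-maximal (C ∷ Cs) (there p) avoids = extendAll-maximal Cs p avoids

      stage-mono : ∀ n → stage n ⊆ stage (suc n)
      stage-mono n = extendAll-⊇ (formulas n)

      Ψ-avoids : Avoids S Δ₀ → Avoids S Ψ
      Ψ-avoids avoids₀ (Bs , hs , d) with ⊩-chain stage stage-mono d
      ... | n , d′ = stage-avoids n (Bs , hs , d′)
        where
          stage-avoids : ∀ n → Avoids S (stage n)
          stage-avoids zero = avoids₀
          stage-avoids (suc n) = extendAll-avoids (formulas n) (stage-avoids n)

      Ψ-maximal : ∀ C → Avoids S (Ψ ∪｛ C ｝) → Ψ C
      Ψ-maximal C avoids with formulas-complete C
      ... | n , p =
        suc n , extendAll-maximal (formulas n) p (Avoids-antitone (map₁ (suc n ,_)) avoids)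

    avoiding-extension : ∀ {S Δ₀} → Avoids S Δ₀ →
                         Σ FSet λ Ψ → InComplement L S Ψ × Δ₀ ⊆ Ψ
    avoiding-extension {S} {Δ₀} avoids₀ =
      Ψ , (maximal-avoiding⇒MaxCons Ψ-avoids′ Ψ-maximal , Avoids⇒disjoint Ψ-avoids′) , (0 ,_)
      where
        open Lindenbaum S Δ₀
        Ψ-avoids′ : Avoids S Ψ
        Ψ-avoids′ = Ψ-avoids avoids₀

lemma3p5 : ExcludedMiddle 0ℓ →
    (L : Logic) (Φ S : FSet) → MaxCons L Φ → IsCut Φ S →
    (A : Formula) → S A ⇔ (∀ (Ψ : FSet) → InComplement L S Ψ → ¬ Ψ A)
lemma3p5 em L Φ S Φ-maxcons S-cut A = mk⇔ (λ SA Ψ (_ , Ψ∩S=∅) ΨA → Ψ∩S=∅ A ΨA SA) from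
  where
    open Deduction L
    open Classical em
    from : (∀ Ψ → InComplement L S Ψ → ¬ Ψ A) → S A
    from A∉Σᶜ = stable λ ¬SA →
      let Ψ , Ψ∈Σᶜ , A∈Ψ = avoiding-extension (cut-avoids Φ-maxcons S-cut ¬SA)
      in A∉Σᶜ Ψ Ψ∈Σᶜ (A∈Ψ refl)
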